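{- Work constructively (IZF). Let $\mathbb{T}$ be a regular theory over a signature $\Sigma$ and $\sigma$ a sequent of the form $\varphi \vdash_{\vec{x}} \bigvee_{i\in I} \psi_i$, where $\varphi$ and each $\psi_i$ are regular formulas and $I$ is a set. If $\sigma$ is derivable from $\mathbb{T}$, then there is some $i\in I$ such that $\varphi\vdash^{\mathbb{T}}_{\vec{x}} \psi_i$.
   Context: Signatures are arbitrary and not assumed discrete. Regular formulas are built from atomic formulas (incl. equality), $\top$, $\wedge$, $\exists$; a regular theory is a set of sequents between regular formulas. Derivability of $\sigma$ is in geometric logic (which additionally allows arbitrary set-indexed disjunctions in a finite context); $\varphi\vdash^{\mathbb{T}}_{\vec x}\psi_i$ denotes derivability from $\mathbb{T}$ in regular logic. -}

module Defs where

-- Geometric and regular logic over an arbitrary (many-sorted) signature,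
-- following Johnstone, Elephant D1.1 / D1.3 (sequent calculus), with
-- de Bruijn variables.  Sorts / symbols are arbitrary types: no decidable
-- equality is assumed (signatures are not assumed discrete).

open import Data.Bool using (Bool; true; false)
open import Data.List using (List; []; _∷_)
open import Data.Product using (Σ; _×_; _,_)

record Signature : Set₁ where
  field
    Sort : Set
    Fun  : List Sort → Sort → Set
    Rel  : List Sort → Set

module _ (S : Signature) where
  open Signature S

  Ctx : Set
  Ctx = List Sort

  data _∋_ : Ctx → Sort → Set where
    here  : ∀ {Γ s} → (s ∷ Γ) ∋ s
    there : ∀ {Γ s t} → Γ ∋ s → (t ∷ Γ) ∋ s

  mutual
    data Term (Γ : Ctx) : Sort → Set where
      var : ∀ {s} → Γ ∋ s → Term Γ s
      fun : ∀ {ss s} → Fun ss s → Terms Γ ss → Term Γ s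

    data Terms (Γ : Ctx) : List Sort → Set where
      []  : Terms Γ []
      _∷_ : ∀ {s ss} → Term Γ s → Terms Γ ss → Terms Γ (s ∷ ss)

  -- Formulas.  The flag b says whether (set-indexed) disjunctions are
  -- allowed: Formula true = geometric formulas, Formula false = regular
  -- formulas (atomic incl. equality, ⊤, ∧, ∃).
  data Formula : Bool → Ctx → Set₁ where
    rel  : ∀ {b Γ ss} → Rel ss → Terms Γ ss → Formula b Γ
    _≐_  : ∀ {b Γ s} → Term Γ s → Term Γ s → Formula b Γ
    ⊤'   : ∀ {b Γ} → Formula b Γ
    _∧'_ : ∀ {b Γ} → Formula b Γ → Formula b Γ → Formula b Γ
    ∃'   : ∀ {b Γ} (s : Sort) → Formula b (s ∷ Γ) → Formula b Γ
    ⋁    : ∀ {Γ} (I : Set) → (I → Formula true Γ) → Formula true Γ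

  RFormula : Ctx → Set₁
  RFormula = Formula false

  GFormula : Ctx → Set₁
  GFormula = Formula true

  emb : ∀ {b Γ} → RFormula Γ → Formula b Γ
  emb (rel R ts) = rel R ts
  emb (t ≐ u)    = t ≐ u
  emb ⊤'         = ⊤'
  emb (φ ∧' ψ)   = emb φ ∧' emb ψ
  emb (∃' s φ)   = ∃' s (emb φ)

  Ren : Ctx → Ctx → Set
  Ren Γ Δ = ∀ {s} → Γ ∋ s → Δ ∋ s

  liftRen : ∀ {Γ Δ t} → Ren Γ Δ → Ren (t ∷ Γ) (t ∷ Δ)
  liftRen ρ here      = here
  liftRen ρ (there x) = there (ρ x)

  mutual
    renT : ∀ {Γ Δ s} → Ren Γ Δ → Term Γ s → Term Δ s
    renT ρ (var x)    = var (ρ x)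
    renT ρ (fun f ts) = fun f (renTs ρ ts)

    renTs : ∀ {Γ Δ ss} → Ren Γ Δ → Terms Γ ss → Terms Δ ss
    renTs ρ []       = []
    renTs ρ (t ∷ ts) = renT ρ t ∷ renTs ρ ts

  Sub : Ctx → Ctx → Set
  Sub Γ Δ = ∀ {s} → Γ ∋ s → Term Δ s

  liftSub : ∀ {Γ Δ t} → Sub Γ Δ → Sub (t ∷ Γ) (t ∷ Δ)
  liftSub σ here      = var here
  liftSub σ (there x) = renT there (σ x)

  mutual
    subT : ∀ {Γ Δ s} → Sub Γ Δ → Term Γ s → Term Δ s
    subT σ (var x)    = σ x
    subT σ (fun f ts) = fun f (subTs σ ts)

    subTs : ∀ {Γ Δ ss} → Sub Γ Δ → Terms Γ ss → Terms Δ ss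
    subTs σ []       = []
    subTs σ (t ∷ ts) = subT σ t ∷ subTs σ ts

  subF : ∀ {b Γ Δ} → Sub Γ Δ → Formula b Γ → Formula b Δ
  subF σ (rel R ts) = rel R (subTs σ ts)
  subF σ (t ≐ u)    = subT σ t ≐ subT σ u
  subF σ ⊤'         = ⊤'
  subF σ (φ ∧' ψ)   = subF σ φ ∧' subF σ ψ
  subF σ (∃' s φ)   = ∃' s (subF (liftSub σ) φ)
  subF σ (⋁ I φs)   = ⋁ I (λ i → subF σ (φs i))

  wk : ∀ {b Γ} {t : Sort} → Formula b Γ → Formula b (t ∷ Γ)
  wk = subF (λ x → var (there x))

  σx : ∀ {Γ s} → Sub (s ∷ Γ) (s ∷ s ∷ Γ)
  σx here      = var here
  σx (there v) = var (there (there v))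

  σy : ∀ {Γ s} → Sub (s ∷ Γ) (s ∷ s ∷ Γ)
  σy here      = var (there here)
  σy (there v) = var (there (there v))

  RSequent : Set₁
  RSequent = Σ Ctx (λ Γ → RFormula Γ × RFormula Γ)

  Theory : Set₁
  Theory = RSequent → Set

  -- Derivability (Elephant D1.3.1).  Deriv T true = geometric logic,
  -- Deriv T false = regular logic (the disjunction rules and the
  -- distributive rule only exist for geometric formulas).
  data Deriv (T : Theory) : (b : Bool) (Γ : Ctx) → Formula b Γ → Formula b Γ → Set₁ where
    axiom : ∀ {b Γ} {φ ψ : RFormula Γ} → T (Γ , φ , ψ) → Deriv T b Γ (emb φ) (emb ψ)
    identity : ∀ {b Γ} {φ : Formula b Γ} → Deriv T b Γ φ φ
    cut : ∀ {b Γ} {φ ψ χ : Formula b Γ} →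
          Deriv T b Γ φ ψ → Deriv T b Γ ψ χ → Deriv T b Γ φ χ
    substitution : ∀ {b Γ Δ} {φ ψ : Formula b Γ} (σ : Sub Γ Δ) →
          Deriv T b Γ φ ψ → Deriv T b Δ (subF σ φ) (subF σ ψ)
    eq-refl : ∀ {b Γ s} → Deriv T b (s ∷ Γ) ⊤' (var here ≐ var here)
    eq-subst : ∀ {b Γ s} (φ : Formula b (s ∷ Γ)) →
          Deriv T b (s ∷ s ∷ Γ) ((var here ≐ var (there here)) ∧' subF σx φ) (subF σy φ)
    ⊤-intro : ∀ {b Γ} {φ : Formula b Γ} → Deriv T b Γ φ ⊤'
    ∧-elimˡ : ∀ {b Γ} {φ ψ : Formula b Γ} → Deriv T b Γ (φ ∧' ψ) φ
    ∧-elimʳ : ∀ {b Γ} {φ ψ : Formula b Γ} → Deriv T b Γ (φ ∧' ψ) ψ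
    ∧-intro : ∀ {b Γ} {φ ψ χ : Formula b Γ} →
          Deriv T b Γ φ ψ → Deriv T b Γ φ χ → Deriv T b Γ φ (ψ ∧' χ)
    ⋁-intro : ∀ {Γ} {I : Set} {φs : I → GFormula Γ} (i : I) →
          Deriv T true Γ (φs i) (⋁ I φs)
    ⋁-elim : ∀ {Γ} {I : Set} {φs : I → GFormula Γ} {ψ : GFormula Γ} →
          ((i : I) → Deriv T true Γ (φs i) ψ) → Deriv T true Γ (⋁ I φs) ψ
    -- existential rules (the double rule, both directions)
    ∃-elim : ∀ {b Γ s} {φ : Formula b (s ∷ Γ)} {ψ : Formula b Γ} →
          Deriv T b (s ∷ Γ) φ (wk ψ) → Deriv T b Γ (∃' s φ) ψ
    ∃-inv : ∀ {b Γ s} {φ : Formula b (s ∷ Γ)} {ψ : Formula b Γ} →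
          Deriv T b Γ (∃' s φ) ψ → Deriv T b (s ∷ Γ) φ (wk ψ)
    distributive : ∀ {Γ} {φ : GFormula Γ} {I : Set} {ψs : I → GFormula Γ} →
          Deriv T true Γ (φ ∧' ⋁ I ψs) (⋁ I (λ i → φ ∧' ψs i))
    frobenius : ∀ {b Γ s} {φ : Formula b Γ} {ψ : Formula b (s ∷ Γ)} →
          Deriv T b Γ (φ ∧' ∃' s ψ) (∃' s (wk φ ∧' ψ))

module Submission where

-- Every geometric formula is a set-indexed disjunction of regular formulas
-- (its disjuncts).  Induction on geometric derivations shows that from
-- α ⊢ β each disjunct of α regularly entails some disjunct of β: every rule
-- of geometric logic acts disjunct by disjunct, the disjunction rules and the
-- distributive axiom merely re-index, and the witnessing disjunct of β is
-- chosen constructively along the derivation.  A regular formula is its own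
-- unique disjunct, which gives the theorem.

open import Defs
open import Data.Bool using (true; false)
open import Data.Product using (∃-syntax; Σ; _,_; _×_)
open import Data.Unit using (⊤; tt)
open import Relation.Binary.PropositionalEquality using (_≡_; refl; cong; cong₂; sym; subst; subst₂)

module _ (S : Signature) where

  Disjunct : ∀ {Γ} → GFormula S Γ → Set
  Disjunct (rel R ts) = ⊤
  Disjunct (t ≐ u)    = ⊤
  Disjunct ⊤'         = ⊤
  Disjunct (α ∧' β)   = Disjunct α × Disjunct β
  Disjunct (∃' s α)   = Disjunct α
  Disjunct (⋁ I αs)   = Σ I (λ i → Disjunct (αs i))

  disjunct : ∀ {Γ} (α : GFormula S Γ) → Disjunct α → RFormula S Γ
  disjunct (rel R ts) _       = rel R ts
  disjunct (t ≐ u)    _       = t ≐ u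
  disjunct ⊤'         _       = ⊤'
  disjunct (α ∧' β)   (j , k) = disjunct α j ∧' disjunct β k
  disjunct (∃' s α)   j       = ∃' s (disjunct α j)
  disjunct (⋁ I αs)   (i , j) = disjunct (αs i) j

  disjunct-subF : ∀ {Γ Δ} (σ : Sub S Γ Δ) (α : GFormula S Γ) (j : Disjunct α) →
    ∃[ j' ] disjunct (subF S σ α) j' ≡ subF S σ (disjunct α j)
  disjunct-subF σ (rel R ts) j       = tt , refl
  disjunct-subF σ (t ≐ u)    j       = tt , refl
  disjunct-subF σ ⊤'         j       = tt , refl
  disjunct-subF σ (α ∧' β)   (j , k) with disjunct-subF σ α j | disjunct-subF σ β k
  ... | j' , eα | k' , eβ = (j' , k') , cong₂ _∧'_ eα eβ
  disjunct-subF σ (∃' s α)   j       with disjunct-subF (liftSub S σ) α j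
  ... | j' , e = j' , cong (∃' s) e
  disjunct-subF σ (⋁ I αs)   (i , j) with disjunct-subF σ (αs i) j
  ... | j' , e = (i , j') , e

  disjunct-subF⁻ : ∀ {Γ Δ} (σ : Sub S Γ Δ) (α : GFormula S Γ) (j' : Disjunct (subF S σ α)) →
    ∃[ j ] disjunct (subF S σ α) j' ≡ subF S σ (disjunct α j)
  disjunct-subF⁻ σ (rel R ts) j'        = tt , refl
  disjunct-subF⁻ σ (t ≐ u)    j'        = tt , refl
  disjunct-subF⁻ σ ⊤'         j'        = tt , refl
  disjunct-subF⁻ σ (α ∧' β)   (j' , k') with disjunct-subF⁻ σ α j' | disjunct-subF⁻ σ β k'
  ... | j , eα | k , eβ = (j , k) , cong₂ _∧'_ eα eβ
  disjunct-subF⁻ σ (∃' s α)   j'        with disjunct-subF⁻ (liftSub S σ) α j'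
  ... | j , e = j , cong (∃' s) e
  disjunct-subF⁻ σ (⋁ I αs)   (i , j')  with disjunct-subF⁻ σ (αs i) j'
  ... | j , e = (i , j) , e

  emb-disjunct : ∀ {Γ} (φ : RFormula S Γ) → Disjunct (emb S φ)
  emb-disjunct (rel R ts) = tt
  emb-disjunct (t ≐ u)    = tt
  emb-disjunct ⊤'         = tt
  emb-disjunct (φ ∧' ψ)   = emb-disjunct φ , emb-disjunct ψ
  emb-disjunct (∃' s φ)   = emb-disjunct φ

  disjunct-emb : ∀ {Γ} (φ : RFormula S Γ) (j : Disjunct (emb S φ)) → disjunct (emb S φ) j ≡ φ
  disjunct-emb (rel R ts) _       = refl
  disjunct-emb (t ≐ u)    _       = refl
  disjunct-emb ⊤'         _       = refl
  disjunct-emb (φ ∧' ψ)   (j , k) = cong₂ _∧'_ (disjunct-emb φ j) (disjunct-emb ψ k)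
  disjunct-emb (∃' s φ)   j       = cong (∃' s) (disjunct-emb φ j)

  emb-regular : ∀ {Γ} (φ : RFormula S Γ) → emb S {false} φ ≡ φ
  emb-regular (rel R ts) = refl
  emb-regular (t ≐ u)    = refl
  emb-regular ⊤'         = refl
  emb-regular (φ ∧' ψ)   = cong₂ _∧'_ (emb-regular φ) (emb-regular ψ)
  emb-regular (∃' s φ)   = cong (∃' s) (emb-regular φ)

module _ (S : Signature) (T : Theory S) where

  RDeriv : ∀ {Γ} → RFormula S Γ → RFormula S Γ → Set₁
  RDeriv {Γ} = Deriv S T false Γ

  DisjunctwiseDeriv : ∀ {Γ} → GFormula S Γ → GFormula S Γ → Set₁
  DisjunctwiseDeriv α β = ∀ j → ∃[ k ] RDeriv (disjunct S α j) (disjunct S β k)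

  deriv⇒disjunctwise : ∀ {Γ} {α β : GFormula S Γ} →
    Deriv S T true Γ α β → DisjunctwiseDeriv α β
  deriv⇒disjunctwise (axiom {φ = φ} {ψ} ax) j =
    emb-disjunct S ψ ,
    subst₂ RDeriv (sym (disjunct-emb S φ j)) (sym (disjunct-emb S ψ _))
      (subst₂ RDeriv (emb-regular S φ) (emb-regular S ψ) (axiom ax))
  deriv⇒disjunctwise identity j = j , identity
  deriv⇒disjunctwise (cut d e) j with deriv⇒disjunctwise d j
  ... | k , d′ with deriv⇒disjunctwise e k
  ... | l , e′ = l , cut d′ e′
  deriv⇒disjunctwise (substitution {φ = φ} {ψ} σ d) j′ with disjunct-subF⁻ S σ φ j′
  ... | j , eφ with deriv⇒disjunctwise d j
  ... | k , d′ with disjunct-subF S σ ψ k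
  ... | k′ , eψ = k′ , subst₂ RDeriv (sym eφ) (sym eψ) (substitution σ d′)
  deriv⇒disjunctwise eq-refl j = tt , eq-refl
  deriv⇒disjunctwise (eq-subst φ) (tt , j′) with disjunct-subF⁻ S (σx S) φ j′
  ... | j , ex with disjunct-subF S (σy S) φ j
  ... | k , ey = k , subst₂ RDeriv (cong (_ ∧'_) (sym ex)) (sym ey) (eq-subst (disjunct S φ j))
  deriv⇒disjunctwise ⊤-intro j = tt , ⊤-intro
  deriv⇒disjunctwise ∧-elimˡ (j , k) = j , ∧-elimˡ
  deriv⇒disjunctwise ∧-elimʳ (j , k) = k , ∧-elimʳ
  deriv⇒disjunctwise (∧-intro d e) j with deriv⇒disjunctwise d j | deriv⇒disjunctwise e j
  ... | k , d′ | l , e′ = (k , l) , ∧-intro d′ e′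
  deriv⇒disjunctwise (⋁-intro i) j = (i , j) , identity
  deriv⇒disjunctwise (⋁-elim ds) (i , j) = deriv⇒disjunctwise (ds i) j
  deriv⇒disjunctwise (∃-elim {ψ = ψ} d) j with deriv⇒disjunctwise d j
  ... | k′ , d′ with disjunct-subF⁻ S _ ψ k′
  ... | k , e = k , ∃-elim (subst (RDeriv _) e d′)
  deriv⇒disjunctwise (∃-inv {ψ = ψ} d) j with deriv⇒disjunctwise d j
  ... | k , d′ with disjunct-subF S _ ψ k
  ... | k′ , e = k′ , subst (RDeriv _) (sym e) (∃-inv d′)
  deriv⇒disjunctwise distributive (j , (i , k)) = (i , (j , k)) , identity
  deriv⇒disjunctwise (frobenius {φ = φ}) (j , k) with disjunct-subF S _ φ j
  ... | j′ , e = (j′ , k) , subst (RDeriv _) (cong (λ χ → ∃' _ (χ ∧' _)) (sym e)) frobenius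

mainTheorem11 : (S : Signature) (T : Theory S) (Γ : Ctx S)
    (φ : RFormula S Γ) (I : Set) (ψs : I → RFormula S Γ) →
    Deriv S T true Γ (emb S φ) (⋁ I (λ i → emb S (ψs i))) →
    ∃[ i ] Deriv S T false Γ φ (ψs i)
mainTheorem11 S T Γ φ I ψs d with deriv⇒disjunctwise S T d (emb-disjunct S φ)
... | (i , k) , d′ = i , subst₂ (RDeriv S T) (disjunct-emb S φ _) (disjunct-emb S (ψs i) k) d′
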